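{- Let $S$ and $T$ be strings and let $(s_1,\dots,s_k)$ be a maximal block decomposition of $S$ with respect to $T$. Then any fragment of $S$ that occurs in $T$ is contained in at most three consecutive blocks. Furthermore, any occurrence in $S$ of a longest common substring of $S$ and $T$ contains the first letter of some block.
   Context: A block decomposition of $S$ with respect to $T$ is a sequence of strings $(s_1,\dots,s_k)$ with $S=s_1s_2\cdots s_k$ such that every $s_i$ is a substring (fragment) of $T$; the $s_i$ are called blocks. It is maximal if $s_is_{i+1}$ is not a substring of $T$ for every $i\in[k-1]$. A fragment of $S$ is $S[i..j]=S[i]\cdots S[j]$ for positions $i\le j$. -}

module Defs where

open import Data.Nat using (ℕ; zero; suc; _+_; _∸_; _≤_; _<_)
open import Data.List using (List; []; _∷_; _++_; length; take; drop; concat)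
open import Data.List.Relation.Unary.All using (All)
open import Data.Product using (Σ; ∃; _×_; _,_)
open import Relation.Nullary using (¬_)
open import Relation.Binary.PropositionalEquality using (_≡_)

-- Strings over an arbitrary alphabet A are lists; positions are 0-indexed.

IsSubstring : {A : Set} → List A → List A → Set
IsSubstring {A} u T = Σ (List A) λ x → Σ (List A) λ y → T ≡ x ++ (u ++ y)

data AllConsecutive {B : Set} (R : B → B → Set) : List B → Set where
  ac-[]  : AllConsecutive R []
  ac-[x] : ∀ {x} → AllConsecutive R (x ∷ [])
  ac-∷   : ∀ {x y zs} → R x y → AllConsecutive R (y ∷ zs) → AllConsecutive R (x ∷ y ∷ zs)

IsBlockDecomposition : {A : Set} → List A → List A → List (List A) → Set
IsBlockDecomposition S T bs = (concat bs ≡ S) × All (λ b → IsSubstring b T) bs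

IsMaximalBlockDecomposition : {A : Set} → List A → List A → List (List A) → Set
IsMaximalBlockDecomposition S T bs =
  IsBlockDecomposition S T bs × AllConsecutive (λ b b′ → ¬ IsSubstring (b ++ b′) T) bs

-- Starting position (0-indexed) of block m (0-indexed) in S, i.e. total length
-- of the first m blocks; equals |S| when m ≥ k.
blockStart : {A : Set} → List (List A) → ℕ → ℕ
blockStart bs m = length (concat (take m bs))

-- The fragment S[i..j] (0-indexed, inclusive; meaningful for i ≤ j < |S|).
fragment : {A : Set} → List A → ℕ → ℕ → List A
fragment S i j = take (suc j ∸ i) (drop i S)

ValidFragment : {A : Set} → List A → ℕ → ℕ → Set
ValidFragment S i j = (i ≤ j) × (j < length S)

WithinThreeConsecutiveBlocks : {A : Set} → List (List A) → ℕ → ℕ → Set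
WithinThreeConsecutiveBlocks bs i j =
  ∃ λ m → (blockStart bs m ≤ i) × (j < blockStart bs (m + 3))

IsLongestCommonSubstring : {A : Set} → List A → List A → List A → Set
IsLongestCommonSubstring {A} S T u =
  IsSubstring u S × IsSubstring u T ×
  ((v : List A) → IsSubstring v S → IsSubstring v T → length v ≤ length u)

-- The fragment S[i..j] contains the first letter of some block:
-- some block m < k is nonempty and its first position p = blockStart m has i ≤ p ≤ j.
ContainsFirstLetterOfSomeBlock : {A : Set} → List (List A) → ℕ → ℕ → Set
ContainsFirstLetterOfSomeBlock bs i j =
  ∃ λ m → (m < length bs) × (blockStart bs m < blockStart bs (suc m)) ×
          (i ≤ blockStart bs m) × (blockStart bs m ≤ j)

module Submission where

-- A fragment of S is treated as a window: the n letters of S starting at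
-- position i.  Both claims are proved by induction on the list of blocks,
-- peeling off the first block b.  A window starting at or after the end of b
-- is a window of the remaining blocks shifted by |b|, and block starts shift
-- by |b| as well, so only windows starting inside b need an argument.
--  (1) If such a window occurs in T and reached past the end of the two next
--      blocks b₁ and b₂, it would contain b₁b₂, so b₁b₂ would occur in T,
--      contradicting maximality.  Hence it ends within b, b₁, b₂.
--  (2) Every block is itself a common substring of S and T, so it is no
--      longer than a longest common substring u.  If an occurrence of u starts
--      at the beginning of b it contains the first letter of b; if it starts
--      strictly inside b, then b ends inside it, and the next block starts
--      inside it.  That block exists (u lies within S) and is nonempty, since
--      by maximality no block may follow a substring of T with an empty block.

open import Defs
open import Data.Nat using (ℕ; zero; suc; _+_; _∸_; _≤_; _<_; z≤n; s≤s; z<s)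
open import Data.Nat.Properties
open import Data.List using (List; []; _∷_; _++_; length; take; drop; concat)
open import Data.List.Properties
  using (length-++; length-take; length-drop; ++-assoc; ++-identityʳ)
open import Data.List.Relation.Unary.All using (All; _∷_)
open import Data.Product using (∃; _×_; _,_)
open import Relation.Nullary using (¬_; yes; no; contradiction)
open import Relation.Binary.PropositionalEquality
  using (_≡_; refl; sym; trans; cong; subst; module ≡-Reasoning)

module _ {A : Set} where

  window : ℕ → ℕ → List A → List A
  window i n xs = take n (drop i xs)

  substring-trans : {u v w : List A} → IsSubstring u v → IsSubstring v w → IsSubstring u w
  substring-trans {u} (x , y , refl) (x′ , y′ , refl) =
    x′ ++ x , y ++ y′ ,
    trans (cong (x′ ++_) (trans (++-assoc x (u ++ y) y′) (cong (x ++_) (++-assoc u y y′))))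
          (sym (++-assoc x′ x (u ++ (y ++ y′))))

  prefix-substring : (xs ys : List A) → IsSubstring xs (xs ++ ys)
  prefix-substring xs ys = [] , ys , refl

  suffix-substring : (xs ys : List A) → IsSubstring ys (xs ++ ys)
  suffix-substring xs ys = xs , [] , cong (xs ++_) (sym (++-identityʳ ys))

  length-window : ∀ i n (xs : List A) → i + n ≤ length xs → length (window i n xs) ≡ n
  length-window zero    n xs       fits      = trans (length-take n xs) (m≤n⇒m⊓n≡m fits)
  length-window (suc i) n (x ∷ xs) (s≤s fits) = length-window i n xs fits

  window-++ʳ : ∀ (b : List A) k n ys → window (length b + k) n (b ++ ys) ≡ window k n ys
  window-++ʳ []      k n ys = refl
  window-++ʳ (x ∷ b) k n ys = window-++ʳ b k n ys

  drop-++ˡ : ∀ i (b ys : List A) → i ≤ length b → drop i (b ++ ys) ≡ drop i b ++ ys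
  drop-++ˡ zero    b       ys _          = refl
  drop-++ˡ (suc i) (x ∷ b) ys (s≤s i≤b) = drop-++ˡ i b ys i≤b

  take-++-prefix : ∀ n (p ys : List A) → length p ≤ n → ∃ λ z → take n (p ++ ys) ≡ p ++ z
  take-++-prefix n       []      ys _          = take n ys , refl
  take-++-prefix (suc n) (x ∷ p) ys (s≤s p≤n) with take-++-prefix n p ys p≤n
  ... | z , eq = z , cong (x ∷_) eq

  window-reaches : ∀ i n (b c : List A) → i ≤ length b → length b + length c ≤ i + n →
                   length (drop i b ++ c) ≤ n
  window-reaches i n b c i≤b end = +-cancelˡ-≤ i _ _ (begin
    i + length (drop i b ++ c)        ≡⟨ cong (i +_) (length-++ (drop i b)) ⟩
    i + (length (drop i b) + length c) ≡⟨ cong (λ l → i + (l + length c)) (length-drop i b) ⟩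
    i + (length b ∸ i + length c)      ≡⟨ sym (+-assoc i _ _) ⟩
    i + (length b ∸ i) + length c      ≡⟨ cong (_+ length c) (m+[n∸m]≡n i≤b) ⟩
    length b + length c                ≤⟨ end ⟩
    i + n                              ∎)
    where open ≤-Reasoning

  window-covers : ∀ i n (b c d : List A) → i ≤ length b → length b + length c ≤ i + n →
                  IsSubstring c (window i n (b ++ (c ++ d)))
  window-covers i n b c d i≤b end
    with take-++-prefix n (drop i b ++ c) d (window-reaches i n b c i≤b end)
  ... | z , eq = drop i b , z , (begin
    take n (drop i (b ++ (c ++ d))) ≡⟨ cong (take n) (drop-++ˡ i b (c ++ d) i≤b) ⟩
    take n (drop i b ++ (c ++ d))   ≡⟨ cong (take n) (sym (++-assoc (drop i b) c d)) ⟩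
    take n ((drop i b ++ c) ++ d)   ≡⟨ eq ⟩
    (drop i b ++ c) ++ z            ≡⟨ ++-assoc (drop i b) c z ⟩
    drop i b ++ (c ++ z)            ∎)
    where open ≡-Reasoning

  blockStart-∷ : ∀ (b : List A) bs m → blockStart (b ∷ bs) (suc m) ≡ length b + blockStart bs m
  blockStart-∷ b bs m = length-++ b

  blockStart-one : ∀ (b : List A) bs → blockStart (b ∷ bs) 1 ≡ length b
  blockStart-one b bs = trans (blockStart-∷ b bs 0) (+-identityʳ (length b))

  WithinThree : List (List A) → ℕ → ℕ → Set
  WithinThree bs i n = ∃ λ m → (blockStart bs m ≤ i) × (i + n ≤ blockStart bs (m + 3))

  BlockStartsIn : List (List A) → ℕ → ℕ → Set
  BlockStartsIn bs i n = ∃ λ m → (m < length bs) ×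
    (blockStart bs m < blockStart bs (suc m)) × (i ≤ blockStart bs m) × (blockStart bs m < i + n)

  WithinThree-∷ : ∀ b bs k n → WithinThree bs k n → WithinThree (b ∷ bs) (length b + k) n
  WithinThree-∷ b bs k n (m , start≤k , end≤) = suc m , start′≤ , end′≤
    where
    open ≤-Reasoning
    start′≤ : blockStart (b ∷ bs) (suc m) ≤ length b + k
    start′≤ = begin
      blockStart (b ∷ bs) (suc m) ≡⟨ blockStart-∷ b bs m ⟩
      length b + blockStart bs m  ≤⟨ +-monoʳ-≤ (length b) start≤k ⟩
      length b + k                ∎
    end′≤ : length b + k + n ≤ blockStart (b ∷ bs) (suc m + 3)
    end′≤ = begin
      length b + k + n                 ≡⟨ +-assoc (length b) k n ⟩
      length b + (k + n)               ≤⟨ +-monoʳ-≤ (length b) end≤ ⟩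
      length b + blockStart bs (m + 3) ≡⟨ sym (blockStart-∷ b bs (m + 3)) ⟩
      blockStart (b ∷ bs) (suc m + 3)  ∎

  BlockStartsIn-∷ : ∀ b bs k n → BlockStartsIn bs k n → BlockStartsIn (b ∷ bs) (length b + k) n
  BlockStartsIn-∷ b bs k n (m , m<k , nonempty , k≤start , start<end) =
    suc m , s≤s m<k , nonempty′ , k≤start′ , start′<end
    where
    open ≤-Reasoning
    nonempty′ : blockStart (b ∷ bs) (suc m) < blockStart (b ∷ bs) (suc (suc m))
    nonempty′ = begin-strict
      blockStart (b ∷ bs) (suc m)        ≡⟨ blockStart-∷ b bs m ⟩
      length b + blockStart bs m         <⟨ +-monoʳ-< (length b) nonempty ⟩
      length b + blockStart bs (suc m)   ≡⟨ sym (blockStart-∷ b bs (suc m)) ⟩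
      blockStart (b ∷ bs) (suc (suc m))  ∎
    k≤start′ : length b + k ≤ blockStart (b ∷ bs) (suc m)
    k≤start′ = begin
      length b + k                ≤⟨ +-monoʳ-≤ (length b) k≤start ⟩
      length b + blockStart bs m  ≡⟨ sym (blockStart-∷ b bs m) ⟩
      blockStart (b ∷ bs) (suc m) ∎
    start′<end : blockStart (b ∷ bs) (suc m) < length b + k + n
    start′<end = begin-strict
      blockStart (b ∷ bs) (suc m) ≡⟨ blockStart-∷ b bs m ⟩
      length b + blockStart bs m  <⟨ +-monoʳ-< (length b) start<end ⟩
      length b + (k + n)          ≡⟨ sym (+-assoc (length b) k n) ⟩
      length b + k + n            ∎

  fits-++ʳ : ∀ (b ys : List A) k n → length b + k + n ≤ length (b ++ ys) → k + n ≤ length ys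
  fits-++ʳ b ys k n fits = +-cancelˡ-≤ (length b) _ _ (begin
    length b + (k + n)     ≡⟨ sym (+-assoc (length b) k n) ⟩
    length b + k + n       ≤⟨ fits ⟩
    length (b ++ ys)       ≡⟨ length-++ b ⟩
    length b + length ys   ∎)
    where open ≤-Reasoning

data Position (ℓ : ℕ) : ℕ → Set where
  inside : ∀ {i} → i < ℓ → Position ℓ i
  beyond : ∀ k → Position ℓ (ℓ + k)

position : ∀ ℓ i → Position ℓ i
position zero    i       = beyond i
position (suc ℓ) zero    = inside z<s
position (suc ℓ) (suc i) with position ℓ i
... | inside i<ℓ = inside (s≤s i<ℓ)
... | beyond k   = beyond k

consecutive-tail : ∀ {B : Set} {R : B → B → Set} {x xs} →
                   AllConsecutive R (x ∷ xs) → AllConsecutive R xs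
consecutive-tail ac-[x]      = ac-[]
consecutive-tail (ac-∷ _ rs) = rs

module _ {A : Set} (T : List A) where

  Unjoinable : List A → List A → Set
  Unjoinable b b′ = ¬ IsSubstring (b ++ b′) T

  within-three : ∀ bs i n → AllConsecutive Unjoinable bs → i + n ≤ length (concat bs) →
                 IsSubstring (window i n (concat bs)) T → WithinThree bs i n
  within-three [] i n _ fits _ = 0 , z≤n , fits
  within-three (b ∷ bs) i n maximal fits occurs with position (length b) i
  ... | beyond k = WithinThree-∷ b bs k n
        (within-three bs k n (consecutive-tail maximal) (fits-++ʳ b (concat bs) k n fits)
          (subst (λ w → IsSubstring w T) (window-++ʳ b k n (concat bs)) occurs))
  within-three (b ∷ []) i n _ fits _ | inside _ = 0 , z≤n , fits
  within-three (b ∷ b₁ ∷ []) i n _ fits _ | inside _ = 0 , z≤n , fits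
  within-three (b ∷ b₁ ∷ b₂ ∷ bs) i n (ac-∷ _ (ac-∷ b₁b₂∉T _)) _ occurs | inside i<b
    with i + n ≤? blockStart (b ∷ b₁ ∷ b₂ ∷ bs) 3
  ... | yes end≤ = 0 , z≤n , end≤
  ... | no end≰ = contradiction (substring-trans b₁b₂∈window occurs) b₁b₂∉T
    where
    third-start : blockStart (b ∷ b₁ ∷ b₂ ∷ bs) 3 ≡ length b + length (b₁ ++ b₂)
    third-start = trans (length-++ b) (cong (λ z → length b + length (b₁ ++ z)) (++-identityʳ b₂))
    b₁b₂∈window : IsSubstring (b₁ ++ b₂) (window i n (b ++ (b₁ ++ (b₂ ++ concat bs))))
    b₁b₂∈window =
      subst (λ s → IsSubstring (b₁ ++ b₂) (window i n (b ++ s))) (++-assoc b₁ b₂ (concat bs))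
        (window-covers i n b (b₁ ++ b₂) (concat bs) (<⇒≤ i<b)
          (subst (_≤ i + n) third-start (<⇒≤ (≰⇒> end≰))))

  successor-nonempty : ∀ {b b′} → IsSubstring b T → Unjoinable b b′ → 0 < length b′
  successor-nonempty {b} {[]} b∈T bb′∉T =
    contradiction (subst (λ w → IsSubstring w T) (sym (++-identityʳ b)) b∈T) bb′∉T
  successor-nonempty {b′ = _ ∷ _} _ _ = z<s

  CommonBound : List A → ℕ → Set
  CommonBound xs ℓ = ∀ w → IsSubstring w xs → IsSubstring w T → length w ≤ ℓ

  longest-contains-start : ∀ bs i n → AllConsecutive Unjoinable bs →
    All (λ b → IsSubstring b T) bs → i + suc n ≤ length (concat bs) →
    CommonBound (concat bs) (suc n) → BlockStartsIn bs i (suc n)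
  longest-contains-start [] i n _ _ fits _ = contradiction (≤-trans (m≤n+m (suc n) i) fits) λ ()
  longest-contains-start (b ∷ bs) i n maximal (b∈T ∷ bs∈T) fits longest
    with position (length b) i
  ... | beyond k = BlockStartsIn-∷ b bs k (suc n)
        (longest-contains-start bs k n (consecutive-tail maximal) bs∈T
          (fits-++ʳ b (concat bs) k (suc n) fits)
          (λ w w∈bs w∈T → longest w (substring-trans w∈bs (suffix-substring b (concat bs))) w∈T))
  longest-contains-start (b ∷ bs) zero n _ _ _ _ | inside 0<b =
    0 , z<s , subst (0 <_) (sym (blockStart-one b bs)) 0<b , z≤n , z<s
  longest-contains-start (b ∷ bs) (suc i) n maximal (b∈T ∷ _) fits longest | inside i<b =
    next-block bs maximal fits
    where
    -- b is a common substring, so it ends before the window does.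
    b-ends-in-window : length b < suc i + suc n
    b-ends-in-window = begin-strict
      length b       ≤⟨ longest b (prefix-substring b (concat bs)) b∈T ⟩
      suc n          <⟨ m<n+m (suc n) z<s ⟩
      suc i + suc n  ∎
      where open ≤-Reasoning
    -- The block after b exists, since the window ends inside S, and is nonempty.
    next-block : ∀ bs → AllConsecutive Unjoinable (b ∷ bs) →
                 suc i + suc n ≤ length (concat (b ∷ bs)) → BlockStartsIn (b ∷ bs) (suc i) (suc n)
    next-block [] _ fits′ =
      contradiction (≤-trans fits′ (≤-reflexive (blockStart-one b []))) (<⇒≱ b-ends-in-window)
    next-block (b₁ ∷ bs′) (ac-∷ bb₁∉T _) _ =
      1 , s≤s z<s , b₁-nonempty ,
      subst (suc i ≤_) (sym (blockStart-one b (b₁ ∷ bs′))) (<⇒≤ i<b) ,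
      subst (_< suc i + suc n) (sym (blockStart-one b (b₁ ∷ bs′))) b-ends-in-window
      where
      open ≤-Reasoning
      b₁-nonempty : blockStart (b ∷ b₁ ∷ bs′) 1 < blockStart (b ∷ b₁ ∷ bs′) 2
      b₁-nonempty = begin-strict
        blockStart (b ∷ b₁ ∷ bs′) 1          ≡⟨ blockStart-one b (b₁ ∷ bs′) ⟩
        length b                            ≡⟨ sym (+-identityʳ (length b)) ⟩
        length b + 0                        <⟨ +-monoʳ-< (length b) (successor-nonempty b∈T bb₁∉T) ⟩
        length b + length b₁                ≡⟨ cong (length b +_) (sym (blockStart-one b₁ bs′)) ⟩
        length b + blockStart (b₁ ∷ bs′) 1  ≡⟨ sym (blockStart-∷ b (b₁ ∷ bs′) 1) ⟩
        blockStart (b ∷ b₁ ∷ bs′) 2          ∎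

fragment-window : ∀ {A : Set} (S : List A) {i j} → i ≤ j →
                  fragment S i j ≡ window i (suc (j ∸ i)) S
fragment-window S {i} i≤j = cong (λ n → window i n S) (+-∸-assoc 1 i≤j)

window-end : ∀ {i j} → i ≤ j → i + suc (j ∸ i) ≡ suc j
window-end {i} {j} i≤j = trans (+-suc i (j ∸ i)) (cong suc (m+[n∸m]≡n i≤j))

lemma3p2 : {A : Set} (S T : List A) (bs : List (List A)) →
    IsMaximalBlockDecomposition S T bs →
    ((i j : ℕ) → ValidFragment S i j → IsSubstring (fragment S i j) T →
      WithinThreeConsecutiveBlocks bs i j)
    ×
    ((u : List A) → IsLongestCommonSubstring S T u →
      (i j : ℕ) → ValidFragment S i j → fragment S i j ≡ u →
      ContainsFirstLetterOfSomeBlock bs i j)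
lemma3p2 {A} .(concat bs) T bs ((refl , blocks∈T) , maximal) = three-blocks , first-letter
  where
  S = concat bs
  fits : ∀ {i j} → i ≤ j → j < length S → i + suc (j ∸ i) ≤ length S
  fits i≤j j<S = subst (_≤ length S) (sym (window-end i≤j)) j<S
  three-blocks : (i j : ℕ) → ValidFragment S i j → IsSubstring (fragment S i j) T →
                 WithinThreeConsecutiveBlocks bs i j
  three-blocks i j (i≤j , j<S) occurs
    with within-three T bs i (suc (j ∸ i)) maximal (fits i≤j j<S)
           (subst (λ w → IsSubstring w T) (fragment-window S i≤j) occurs)
  ... | m , start≤i , end≤ = m , start≤i , subst (_≤ blockStart bs (m + 3)) (window-end i≤j) end≤
  first-letter : (u : List A) → IsLongestCommonSubstring S T u →
                 (i j : ℕ) → ValidFragment S i j → fragment S i j ≡ u →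
                 ContainsFirstLetterOfSomeBlock bs i j
  first-letter _ (_ , _ , longest) i j (i≤j , j<S) refl
    with longest-contains-start T bs i (j ∸ i) maximal blocks∈T (fits i≤j j<S)
           (λ w w∈S w∈T → subst (length w ≤_)
             (trans (cong length (fragment-window S i≤j)) (length-window i _ S (fits i≤j j<S)))
             (longest w w∈S w∈T))
  ... | m , m<k , nonempty , i≤start , start<end =
        m , m<k , nonempty , i≤start , ≤-pred (subst (blockStart bs m <_) (window-end i≤j) start<end)
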